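{- Let $T$ be a trie with $n \geq 1$ edges. Then the number of runs in $T$ is less than $n$.
   Context: A trie is a rooted tree whose edges are labeled by symbols of an alphabet $\Sigma$, such that the edges from any node to its children carry pairwise distinct labels. For nodes $u,v$ of the trie with $v$ an ancestor of $u$ (possibly $u=v$), $\mathit{str}(u,v)$ denotes the string obtained by concatenating the edge labels along the path from $u$ up to $v$. For a nonempty string $w$, an integer $1\le p\le |w|$ is a period of $w$ if $w[i]=w[i+p]$ for all $1\le i\le |w|-p$; $\pi(w)$ denotes the smallest period. A run in the trie is a pair $(v_i,v_j)$ of nodes with $v_j$ a proper ancestor of $v_i$ such that $\pi(\mathit{str}(v_i,v_j)) \le |\mathit{str}(v_i,v_j)|/2$, and such that for every descendant $v_{i'}$ of $v_i$ (including $v_i$) and every ancestor $v_{j'}$ of $v_j$ (including $v_j$) with $(v_{i'},v_{j'})\neq(v_i,v_j)$, we have $\pi(\mathit{str}(v_{i'},v_{j'}))\neq \pi(\mathit{str}(v_i,v_j))$. -}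

module Defs where

open import Data.Nat using (ℕ; zero; suc; _+_; _*_; _≤_; _<_)
open import Data.Fin using (Fin; zero; suc; toℕ; inject₁)
open import Data.List using (List; []; _∷_; _++_; length)
open import Data.Maybe using (Maybe; just; nothing)
open import Data.Product using (Σ; _×_; _,_; ∃-syntax)
open import Relation.Binary.PropositionalEquality using (_≡_; _≢_)
open import Relation.Nullary using (¬_)

at : {A : Set} → List A → ℕ → Maybe A
at []       _       = nothing
at (x ∷ xs) zero    = just x
at (x ∷ xs) (suc i) = at xs i

IsPeriod : {A : Set} → ℕ → List A → Set
IsPeriod p w = (1 ≤ p) × (p ≤ length w) ×
  (∀ i → i + p < length w → at w i ≡ at w (i + p))

IsSmallestPeriod : {A : Set} → ℕ → List A → Set
IsSmallestPeriod p w = IsPeriod p w × (∀ q → IsPeriod q w → p ≤ q)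

-- Nodes are Fin (suc n); node 0 is the root; the non-root node (suc i)
-- is joined by the edge i (labelled label i) to its parent (parent i),
-- whose index is strictly smaller (so this is a rooted tree; every rooted
-- tree with n edges admits such a numbering, e.g. BFS order).
record Trie (A : Set) (n : ℕ) : Set where
  field
    parent    : Fin n → Fin (suc n)
    parent<   : ∀ i → toℕ (parent i) < suc (toℕ i)
    label     : Fin n → A
    distinct  : ∀ i j → parent i ≡ parent j → label i ≡ label j → i ≡ j

  Node : Set
  Node = Fin (suc n)

  -- Path u v s : v is an ancestor of u (possibly u = v) and s = str(u,v),
  -- the labels read along the path from u up to v.
  data Path : Node → Node → List A → Set where
    here : ∀ {u} → Path u u []
    step : ∀ {v s} (i : Fin n) → Path (parent i) v s → Path (suc i) v (label i ∷ s)

  IsRun : Node × Node → Set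
  IsRun (vi , vj) = ∃[ s ] ∃[ p ]
      ( Path vi vj s
      × (1 ≤ length s)                 -- vj is a proper ancestor of vi
      × IsSmallestPeriod p s
      × (2 * p ≤ length s)
      × (∀ vi' vj' t r → Path vi' vi t → Path vj vj' r →
           (vi' , vj') ≢ (vi , vj) →
           ¬ IsSmallestPeriod p (t ++ s ++ r)))

-- Read upwards from vi, a run of period p is periodic, and its continuation past vj (a letter, or the
-- root) is smaller than the letter it would have to repeat under one of two opposite orders of the
-- labels. Under that order the least rotation of the period is a Lyndon word followed by a drop, so
-- the word read upwards from the node where that rotation starts has a Lyndon prefix of length exactly
-- p. Charge the run to the node c just below that point: c determines p (across both orders, because
-- one of them always gives length 1), and two runs of period p through the same c coincide since each
-- letter below c recurs p steps higher and both runs are maximal. Such c is neither the root nor a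
-- child of the root, so a trie with n edges has at most n - 1 runs.

module Submission where

open import Defs
open import Data.Bool using (Bool; true; false)
import Data.Bool as Bool
open import Data.Empty using (⊥; ⊥-elim)
open import Data.Fin using (Fin; zero; suc; toℕ)
open import Data.Fin.Properties using (toℕ-injective; toℕ<n; injective⇒≤; sequence)
open import Data.List using (List; []; _∷_; _++_; length; lookup)
open import Data.List.Properties using (length-++; ++-identityʳ)
open import Data.List.Membership.Propositional.Properties using (∈-lookup)
import Data.List.Relation.Unary.All as All
open import Data.List.Relation.Unary.All using (All)
open import Data.List.Relation.Unary.AllPairs using (_∷_)
open import Data.List.Relation.Unary.Unique.Propositional using (Unique)
open import Data.Maybe using (Maybe; just; nothing)
open import Data.Maybe.Properties using (just-injective)
open import Data.Nat
open import Data.Nat.DivMod using (_%_; _/_; m%n<n; m≡m%n+[m/n]*n; [m+n]%n≡m%n)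
open import Data.Nat.Properties
open import Data.Nat.Tactic.RingSolver using (solve-∀)
open import Data.Product using (∃; ∃-syntax; _×_; _,_; proj₁; proj₂)
open import Data.Sum using (_⊎_; inj₁; inj₂; [_,_]′)
open import Effect.Monad using (RawMonad)
open import Function using (_∘_)
open import Relation.Binary using (Decidable; Transitive; tri<; tri≈; tri>)
open import Relation.Binary.PropositionalEquality
open import Relation.Nullary using (¬_; Dec; yes; no)
open import Relation.Nullary.Decidable using (decidable-stable; ¬¬-excluded-middle)
open import Relation.Nullary.Negation using (¬¬-Monad; ¬¬-map)

private
  variable
    X : Set
    d e j L : ℕ
    f f' g g' h : ℕ → ℕ

Seq : Set
Seq = ℕ → ℕ

shift : ℕ → Seq → Seq
shift i f t = f (i + t)

AgreeBelow : ℕ → (ℕ → X) → (ℕ → X) → Set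
AgreeBelow d f g = ∀ t → t < d → f t ≡ g t

HasPeriodBelow : ℕ → ℕ → (ℕ → X) → Set
HasPeriodBelow L j f = ∀ t → t + j < L → f t ≡ f (t + j)

agreeBelow-sym : {u v : ℕ → X} → AgreeBelow d u v → AgreeBelow d v u
agreeBelow-sym u≗v t t<d = sym (u≗v t t<d)

hasPeriodBelow-resp : {u v : ℕ → X} → AgreeBelow L u v → HasPeriodBelow L j u → HasPeriodBelow L j v
hasPeriodBelow-resp {j = j} u≗v per t t+j<L =
  trans (sym (u≗v t (≤-<-trans (m≤m+n t j) t+j<L))) (trans (per t t+j<L) (u≗v (t + j) t+j<L))

hasPeriodBelow-* : {u : ℕ → X} → HasPeriodBelow L j u → ∀ k t → t + k * j < L → u t ≡ u (t + k * j)
hasPeriodBelow-* {u = u} per zero t _ = cong u (sym (+-identityʳ t))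
hasPeriodBelow-* {L = L} {j = j} {u = u} per (suc k) t t+[1+k]j<L =
  trans (hasPeriodBelow-* per k t (≤-<-trans (+-monoʳ-≤ t (m≤n+m (k * j) j)) t+[1+k]j<L))
        (trans (per (t + k * j) (subst (_< L) (sym step) t+[1+k]j<L)) (cong u step))
  where
  step : t + k * j + j ≡ t + suc k * j
  step = trans (+-assoc t (k * j) j) (cong (t +_) (+-comm (k * j) j))

hasPeriodBelow-% : ∀ {p} .{{_ : NonZero p}} {u : ℕ → X} →
  HasPeriodBelow L p u → ∀ t → t < L → u t ≡ u (t % p)
hasPeriodBelow-% {L = L} {p = p} {u = u} per t t<L =
  sym (trans (hasPeriodBelow-* per (t / p) (t % p) (subst (_< L) (m≡m%n+[m/n]*n t p) t<L))
             (cong u (sym (m≡m%n+[m/n]*n t p))))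

LexAt : ℕ → Seq → Seq → Set
LexAt d f g = AgreeBelow d f g × f d < g d

_<ₗₑₓ_ : Seq → Seq → Set
f <ₗₑₓ g = ∃[ d ] LexAt d f g

lexAt-asym : LexAt d f g → ¬ LexAt e g f
lexAt-asym {d} {e = e} (f≗g , fd<gd) (g≗f , ge<fe) with <-cmp d e
... | tri< d<e _ _  = <-irrefl (sym (g≗f d d<e)) fd<gd
... | tri≈ _ refl _ = <-asym fd<gd ge<fe
... | tri> _ _ e<d  = <-irrefl (sym (f≗g e e<d)) ge<fe

lexAt-irrefl : ¬ LexAt d f f
lexAt-irrefl (_ , fd<fd) = <-irrefl refl fd<fd

lexAt-trans : LexAt d f g → LexAt e g h → ∃[ c ] c ≤ d × LexAt c f h
lexAt-trans {d} {f} {e = e} {h = h} (f≗g , fd<gd) (g≗h , ge<he) with <-cmp d e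
... | tri< d<e _ _  = d , ≤-refl ,
  (λ t t<d → trans (f≗g t t<d) (g≗h t (<-trans t<d d<e))) , subst (f d <_) (g≗h d d<e) fd<gd
... | tri≈ _ refl _ = d , ≤-refl , (λ t t<d → trans (f≗g t t<d) (g≗h t t<d)) , <-trans fd<gd ge<he
... | tri> _ _ e<d  = e , <⇒≤ e<d ,
  (λ t t<e → trans (f≗g t (<-trans t<e e<d)) (g≗h t t<e)) , subst (_< h e) (sym (f≗g e e<d)) ge<he

lexAt-resp : AgreeBelow (suc d) f f' → AgreeBelow (suc d) g g' → LexAt d f g → LexAt d f' g'
lexAt-resp {d} f≗f' g≗g' (f≗g , fd<gd) =
  (λ t t<d → trans (sym (f≗f' t (m<n⇒m<1+n t<d))) (trans (f≗g t t<d) (g≗g' t (m<n⇒m<1+n t<d)))) ,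
  subst₂ _<_ (f≗f' d ≤-refl) (g≗g' d ≤-refl) fd<gd

<ₗₑₓ-asym : f <ₗₑₓ g → ¬ g <ₗₑₓ f
<ₗₑₓ-asym (_ , f<g) (_ , g<f) = lexAt-asym f<g g<f

<ₗₑₓ-trans : f <ₗₑₓ g → g <ₗₑₓ h → f <ₗₑₓ h
<ₗₑₓ-trans (_ , f<g) (_ , g<h) = let (c , _ , f<h) = lexAt-trans f<g g<h in c , f<h

<ₗₑₓ-resp : f ≗ f' → g ≗ g' → f <ₗₑₓ g → f' <ₗₑₓ g'
<ₗₑₓ-resp f≗f' g≗g' (d , f<g) = d , lexAt-resp (λ t _ → f≗f' t) (λ t _ → g≗g' t) f<g

<ₗₑₓ-tail : f 0 ≡ g 0 → f <ₗₑₓ g → shift 1 f <ₗₑₓ shift 1 g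
<ₗₑₓ-tail f0≡g0 (zero , _ , f0<g0)   = ⊥-elim (<-irrefl f0≡g0 f0<g0)
<ₗₑₓ-tail _     (suc d , f≗g , fd<gd) = d , (λ t t<d → f≗g (suc t) (s≤s t<d)) , fd<gd

firstDifference : ∀ N (f g : Seq) → (∃[ d ] d < N × AgreeBelow d f g × f d ≢ g d) ⊎ AgreeBelow N f g
firstDifference zero    f g = inj₂ (λ _ ())
firstDifference (suc N) f g with firstDifference N f g
... | inj₁ (d , d<N , f≗g , fd≢gd) = inj₁ (d , m<n⇒m<1+n d<N , f≗g , fd≢gd)
... | inj₂ f≗g with f N ≟ g N
...   | yes fN≡gN = inj₂ λ t t<1+N → [ f≗g t , (λ { refl → fN≡gN }) ]′ (m<1+n⇒m<n∨m≡n t<1+N)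
...   | no  fN≢gN = inj₁ (N , ≤-refl , f≗g , fN≢gN)

compareBelow : ∀ N (f g : Seq) →
  (∃[ d ] d < N × LexAt d f g) ⊎ AgreeBelow N f g ⊎ (∃[ d ] d < N × LexAt d g f)
compareBelow N f g with firstDifference N f g
... | inj₂ f≗g = inj₂ (inj₁ f≗g)
... | inj₁ (d , d<N , f≗g , fd≢gd) with <-cmp (f d) (g d)
...   | tri< fd<gd _ _ = inj₁ (d , d<N , f≗g , fd<gd)
...   | tri≈ _ fd≡gd _ = ⊥-elim (fd≢gd fd≡gd)
...   | tri> _ _ gd<fd = inj₂ (inj₂ (d , d<N , agreeBelow-sym f≗g , gd<fd))

module _ {_≺_ : ℕ → ℕ → Set} (≺? : Decidable _≺_) (≺-trans : Transitive _≺_) (≺-irrefl : ∀ {x} → ¬ x ≺ x) where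

  ≺-minimalUpTo : ∀ N → ∃[ i ] i ≤ N × (∀ m → m ≤ N → ¬ m ≺ i)
  ≺-minimalUpTo zero = 0 , z≤n , λ { _ z≤n → ≺-irrefl }
  ≺-minimalUpTo (suc N) with ≺-minimalUpTo N
  ... | i , i≤N , i-min with ≺? (suc N) i
  ...   | yes N+1≺i = suc N , ≤-refl , λ m m≤1+N m≺N+1 →
    [ (λ m<1+N → i-min m (s≤s⁻¹ m<1+N) (≺-trans m≺N+1 N+1≺i)) , (λ { refl → ≺-irrefl m≺N+1 }) ]′
      (m≤n⇒m<n∨m≡n m≤1+N)
  ...   | no  N+1⊀i = i , m≤n⇒m≤1+n i≤N , λ m m≤1+N →
    [ (λ m<1+N → i-min m (s≤s⁻¹ m<1+N)) , (λ { refl → N+1⊀i }) ]′ (m≤n⇒m<n∨m≡n m≤1+N)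

shift-agree⇒constant : ∀ {N} → AgreeBelow N (shift 1 f) f → ∀ t → t ≤ N → f t ≡ f 0
shift-agree⇒constant step zero    _   = refl
shift-agree⇒constant step (suc t) t<N = trans (step t t<N) (shift-agree⇒constant step t (<⇒≤ t<N))

-- The length-p windows of a sequence with shortest period p are its rotations; a lexicographically
-- least window starts a Lyndon word, i.e. it is smaller than each of its proper rotations.
module MinimalRotation (P : Seq) (q : ℕ) (periodic : ∀ t → P (t + suc q) ≡ P t)
  (noShorterPeriod : ∀ j → 0 < j → j < suc q → ¬ (∀ t → P (t + j) ≡ P t)) where

  p : ℕ
  p = suc q

  periodic-* : ∀ k t → P (t + k * p) ≡ P t
  periodic-* zero    t = cong P (+-identityʳ t)
  periodic-* (suc k) t = begin
    P (t + (p + k * p)) ≡⟨ cong P (trans (cong (t +_) (+-comm p (k * p))) (sym (+-assoc t (k * p) p))) ⟩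
    P (t + k * p + p)   ≡⟨ periodic (t + k * p) ⟩
    P (t + k * p)       ≡⟨ periodic-* k t ⟩
    P t                 ∎
    where open ≡-Reasoning

  _≺_ : ℕ → ℕ → Set
  x ≺ y = ∃[ d ] d < p × LexAt d (shift x P) (shift y P)

  _≈_ : ℕ → ℕ → Set
  x ≈ y = AgreeBelow p (shift x P) (shift y P)

  ≺-trichotomy : ∀ x y → x ≺ y ⊎ x ≈ y ⊎ y ≺ x
  ≺-trichotomy x y = compareBelow p (shift x P) (shift y P)

  ≺? : Decidable _≺_
  ≺? x y with ≺-trichotomy x y
  ... | inj₁ x≺y                 = yes x≺y
  ... | inj₂ (inj₁ x≈y)          = no λ { (d , d<p , _ , lt) → <-irrefl (x≈y d d<p) lt }
  ... | inj₂ (inj₂ (_ , _ , y<x)) = no λ { (_ , _ , x<y) → lexAt-asym x<y y<x }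

  ≺-trans : Transitive _≺_
  ≺-trans (_ , d<p , x<y) (_ , _ , y<z) =
    let (c , c≤d , x<z) = lexAt-trans x<y y<z in c , ≤-<-trans c≤d d<p , x<z

  ≺-irrefl : ∀ {x} → ¬ x ≺ x
  ≺-irrefl (_ , _ , x<x) = lexAt-irrefl x<x

  window-rep : ∀ x → ∃[ r ] r < p × shift x P ≗ shift (suc r) P
  window-rep x = r , m%n<n (x + q) p , λ t → begin
    P (x + t)             ≡⟨ sym (periodic (x + t)) ⟩
    P (x + t + p)         ≡⟨ cong P (trans (rearrange₁ x t q) (trans (cong (λ z → suc z + t) split) (rearrange₂ r t k q))) ⟩
    P (suc r + t + k * p) ≡⟨ periodic-* k (suc r + t) ⟩
    P (suc r + t)         ∎
    where
    open ≡-Reasoning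
    r : ℕ
    r = (x + q) % p
    k : ℕ
    k = (x + q) / p
    split : x + q ≡ r + k * p
    split = m≡m%n+[m/n]*n (x + q) p
    rearrange₁ : ∀ x t q → x + t + suc q ≡ suc (x + q) + t
    rearrange₁ = solve-∀
    rearrange₂ : ∀ r t k q → suc (r + k * suc q) + t ≡ suc r + t + k * suc q
    rearrange₂ = solve-∀

  ≈⇒period : ∀ y j → (y + j) ≈ y → ∀ t → P (t + j) ≡ P t
  ≈⇒period y j window t = begin
    P (t + j)                 ≡⟨ sym (periodic-* y (t + j)) ⟩
    P (t + j + y * p)         ≡⟨ cong P (rearrange₁ t j y q) ⟩
    P (y + j + (t + y * q))   ≡⟨ everywhere (t + y * q) ⟩
    P (y + (t + y * q))       ≡⟨ cong P (rearrange₂ t y q) ⟩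
    P (t + y * p)             ≡⟨ periodic-* y t ⟩
    P t                       ∎
    where
    open ≡-Reasoning
    rearrange₁ : ∀ t j y q → t + j + y * suc q ≡ y + j + (t + y * q)
    rearrange₁ = solve-∀
    rearrange₂ : ∀ t y q → y + (t + y * q) ≡ t + y * suc q
    rearrange₂ = solve-∀
    split : ∀ z u → z + u ≡ z + u % p + u / p * p
    split z u = trans (cong (z +_) (m≡m%n+[m/n]*n u p)) (sym (+-assoc z (u % p) (u / p * p)))
    everywhere : ∀ u → P (y + j + u) ≡ P (y + u)
    everywhere u = begin
      P (y + j + u)                   ≡⟨ cong P (split (y + j) u) ⟩
      P (y + j + u % p + u / p * p)   ≡⟨ periodic-* (u / p) (y + j + u % p) ⟩
      P (y + j + u % p)               ≡⟨ window (u % p) (m%n<n u p) ⟩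
      P (y + u % p)                   ≡⟨ sym (periodic-* (u / p) (y + u % p)) ⟩
      P (y + u % p + u / p * p)       ≡⟨ cong P (sym (split y u)) ⟩
      P (y + u)                       ∎

  minimalWindow : ∃[ i ] 1 ≤ i × i ≤ p × (∀ x → ¬ x ≺ i)
  minimalWindow with ≺-minimalUpTo {_≺_ = λ x y → suc x ≺ suc y} (λ x y → ≺? (suc x) (suc y)) ≺-trans ≺-irrefl q
  ... | r , r≤q , r-min = suc r , s≤s z≤n , s≤s r≤q , minimal
    where
    minimal : ∀ x → ¬ x ≺ suc r
    minimal x (d , d<p , x<r) with window-rep x
    ... | r' , r'<p , x≗r' = r-min r' (s≤s⁻¹ r'<p) (d , d<p , lexAt-resp (λ t _ → x≗r' t) (λ _ _ → refl) x<r)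

  Lyndon : ℕ → Set
  Lyndon i = ∀ j → 0 < j → j < p → ∃[ d ] d + j < p × LexAt d (shift i P) (shift (i + j) P)

  lexAt-rotate : ∀ {i j k e} → j + k ≡ p →
    LexAt (k + e) (shift i P) (shift (i + j) P) → LexAt e (shift (i + k) P) (shift i P)
  lexAt-rotate {i} {j} {k} {e} j+k≡p (agree , lt) =
    (λ t t<e → trans (cong P (+-assoc i k t)) (trans (agree (k + t) (+-monoʳ-< k t<e)) (wrap t))) ,
    subst₂ _<_ (cong P (sym (+-assoc i k e))) (wrap e) lt
    where
    rearrange : ∀ i j k t → i + j + (k + t) ≡ i + t + (j + k)
    rearrange = solve-∀
    wrap : ∀ t → P (i + j + (k + t)) ≡ P (i + t)
    wrap t = trans (cong P (trans (rearrange i j k t) (cong (i + t +_) j+k≡p))) (periodic (i + t))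

  rotationsAgree⇒⊥ : ∀ {i j k} → (∀ x → ¬ x ≺ i) → 0 < j → j < p → j + k ≡ p →
    AgreeBelow k (shift i P) (shift (i + j) P) → ⊥
  rotationsAgree⇒⊥ {i} {j} {k} minimal 0<j j<p j+k≡p prefix with ≺-trichotomy (i + j) i
  ... | inj₁ i+j≺i        = minimal (i + j) i+j≺i
  ... | inj₂ (inj₁ i+j≈i) = noShorterPeriod j 0<j j<p (≈⇒period i j i+j≈i)
  ... | inj₂ (inj₂ (d , d<p , i<i+j)) with k ≤? d
  ...   | no  k≰d = <-irrefl (prefix d (≰⇒> k≰d)) (proj₂ i<i+j)
  ...   | yes k≤d with m≤n⇒∃[o]m+o≡n k≤d
  ...     | e , refl = minimal (i + k) (e , ≤-<-trans (m≤n+m e k) d<p , lexAt-rotate j+k≡p i<i+j)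

  minimal⇒lyndon : ∀ {i} → (∀ x → ¬ x ≺ i) → Lyndon i
  minimal⇒lyndon {i} minimal j 0<j j<p with m≤n⇒∃[o]m+o≡n (<⇒≤ j<p)
  ... | k , j+k≡p with compareBelow k (shift i P) (shift (i + j) P)
  ... | inj₁ (d , d<k , i<i+j) =
    d , subst (d + j <_) (trans (+-comm k j) j+k≡p) (+-monoˡ-< j d<k) , i<i+j
  ... | inj₂ (inj₁ prefix) = ⊥-elim (rotationsAgree⇒⊥ minimal 0<j j<p j+k≡p prefix)
  ... | inj₂ (inj₂ (d , d<k , i+j<i)) =
    ⊥-elim (minimal (i + j) (d , <-trans d<k (subst (k <_) j+k≡p (m<n+m k 0<j)) , i+j<i))

  lyndonPosition : ∃[ i ] 1 ≤ i × i ≤ p × Lyndon i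
  lyndonPosition = let (i , 1≤i , i≤p , minimal) = minimalWindow in i , 1≤i , i≤p , minimal⇒lyndon minimal

-- The Lyndon root at the start of w has length p: w is smaller than its suffixes shift j w for
-- 0 < j < p, while shift p w is smaller than w.
LyndonPrefix : Seq → ℕ → Set
LyndonPrefix w p = (∀ j → 0 < j → j < p → w <ₗₑₓ shift j w) × shift p w <ₗₑₓ w

lyndonPrefix-resp : ∀ {p} → f ≗ g → LyndonPrefix f p → LyndonPrefix g p
lyndonPrefix-resp {p = p} f≗g (smaller , drops) =
  (λ j 0<j j<p → <ₗₑₓ-resp f≗g (λ t → f≗g (j + t)) (smaller j 0<j j<p)) ,
  <ₗₑₓ-resp (λ t → f≗g (p + t)) f≗g drops

lyndonPrefix-unique : ∀ {p p'} → LyndonPrefix f p → LyndonPrefix f p' → 0 < p → 0 < p' → p ≡ p'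
lyndonPrefix-unique {p = p} {p'} (smaller , drops) (smaller' , drops') 0<p 0<p' with <-cmp p p'
... | tri< p<p' _ _ = ⊥-elim (<ₗₑₓ-asym drops (smaller' p 0<p p<p'))
... | tri≈ _ p≡p' _ = p≡p'
... | tri> _ _ p'<p = ⊥-elim (<ₗₑₓ-asym drops' (smaller p' 0<p' p'<p))

lyndonPrefix-head : ∀ {r} → LyndonPrefix f (2 + r) → f (1 + r) ≢ f 0
lyndonPrefix-head {f} {r} (smaller , drops) f[1+r]≡f0 =
  <ₗₑₓ-asym tails (<ₗₑₓ-trans drops (smaller 1 z<s (s≤s (s≤s z≤n))))
  where
  tails : shift 1 f <ₗₑₓ shift (2 + r) f
  tails = <ₗₑₓ-resp (λ _ → refl) (λ t → cong (f ∘ suc) (+-suc r t))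
    (<ₗₑₓ-tail (sym (trans (cong f (+-identityʳ (suc r))) f[1+r]≡f0)) (smaller (suc r) z<s ≤-refl))

module _ {q L m : ℕ} (g : Seq) (2p≤L : suc q + suc q ≤ L) (periodic : HasPeriodBelow L (suc q) g)
  (noShorterPeriod : ∀ j → 0 < j → j < suc q → ¬ HasPeriodBelow L j g)
  (m+p≡L : m + suc q ≡ L) (g-drops : g L < g m) where

  private
    p : ℕ
    p = suc q

    P : Seq
    P t = g (t % p)

    g≡P : ∀ t → t < L → g t ≡ P t
    g≡P = hasPeriodBelow-% periodic

    P-periodic : ∀ t → P (t + p) ≡ P t
    P-periodic t = cong g ([m+n]%n≡m%n t p)

    P-noShorterPeriod : ∀ j → 0 < j → j < p → ¬ (∀ t → P (t + j) ≡ P t)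
    P-noShorterPeriod j 0<j j<p P-period = noShorterPeriod j 0<j j<p λ t t+j<L →
      trans (g≡P t (≤-<-trans (m≤m+n t j) t+j<L)) (trans (sym (P-period t)) (sym (g≡P (t + j) t+j<L)))

    p≤m : p ≤ m
    p≤m = +-cancelʳ-≤ p p m (subst (p + p ≤_) (sym m+p≡L) 2p≤L)

  lyndonPrefix-exists : ∃[ i ] 1 ≤ i × i ≤ p × LyndonPrefix (shift i g) p
  lyndonPrefix-exists with MinimalRotation.lyndonPosition P q P-periodic P-noShorterPeriod
  ... | i , 1≤i , i≤p , lyndon = i , 1≤i , i≤p , smaller , drops
    where
    inside : ∀ {x} → x < p → i + x < L
    inside {x} x<p = <-≤-trans (+-monoʳ-< i x<p) (≤-trans (+-monoˡ-≤ p i≤p) 2p≤L)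

    smaller : ∀ j → 0 < j → j < p → shift i g <ₗₑₓ shift j (shift i g)
    smaller j 0<j j<p with lyndon j 0<j j<p
    ... | d , d+j<p , lex = d , lexAt-resp
      (λ t t≤d → sym (g≡P (i + t) (inside (≤-<-trans (s≤s⁻¹ t≤d) (≤-<-trans (m≤m+n d j) d+j<p)))))
      (λ t t≤d → trans (cong P (+-assoc i j t))
        (sym (g≡P (i + (j + t)) (inside (≤-<-trans (+-monoʳ-≤ j (s≤s⁻¹ t≤d)) (subst (_< p) (+-comm d j) d+j<p))))))
      lex

    drops : shift p (shift i g) <ₗₑₓ shift i g
    drops with m≤n⇒∃[o]m+o≡n (≤-trans i≤p p≤m)
    ... | d , refl = d ,
      (λ t t<d → trans (cong g (reorder t)) (sym (periodic (i + t)
        (subst (i + t + p <_) m+p≡L (+-monoˡ-< p (+-monoʳ-< i t<d)))))) ,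
      subst (_< g (i + d)) (cong g (sym (trans (reorder d) m+p≡L))) g-drops
      where
      reorder : ∀ t → i + (p + t) ≡ i + t + p
      reorder t = trans (cong (i +_) (+-comm p t)) (sym (+-assoc i t p))

module _ {A : Set} where

  at-++ˡ : (xs ys : List A) → ∀ {t} → t < length xs → at (xs ++ ys) t ≡ at xs t
  at-++ˡ (x ∷ xs) ys {zero}  _          = refl
  at-++ˡ (x ∷ xs) ys {suc t} (s≤s t<n) = at-++ˡ xs ys t<n

  at-++ʳ : (xs ys : List A) → ∀ t → at (xs ++ ys) (length xs + t) ≡ at ys t
  at-++ʳ []       ys t = refl
  at-++ʳ (x ∷ xs) ys t = at-++ʳ xs ys t

  at-defined : (xs : List A) → ∀ {t} → t < length xs → ∃[ x ] at xs t ≡ just x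
  at-defined (x ∷ xs) {zero}  _          = x , refl
  at-defined (x ∷ xs) {suc t} (s≤s t<n) = at-defined xs t<n

  smallestPeriod-extend : ∀ {p} {s w : List A} → IsSmallestPeriod p s →
    HasPeriodBelow (length w) p (at w) → length s ≤ length w →
    (∀ j → j ≤ length s → IsPeriod j w → HasPeriodBelow (length s) j (at s)) →
    IsSmallestPeriod p w
  smallestPeriod-extend {p} {s} {w} ((1≤p , p≤|s| , _) , least) periodic |s|≤|w| restrict =
    (1≤p , ≤-trans p≤|s| |s|≤|w| , periodic) , shortest
    where
    shortest : ∀ j → IsPeriod j w → p ≤ j
    shortest j j-period@(1≤j , _ , _) with j ≤? length s
    ... | yes j≤|s| = least j (1≤j , j≤|s| , restrict j j≤|s| j-period)
    ... | no  j≰|s| = ≤-trans p≤|s| (<⇒≤ (≰⇒> j≰|s|))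

  smallestPeriod-∷ʳ : ∀ {p m x} {s : List A} → IsSmallestPeriod p s → m + p ≡ length s → at s m ≡ just x →
    IsSmallestPeriod p (s ++ x ∷ [])
  smallestPeriod-∷ʳ {p} {m} {x} {s} smallest@((1≤p , _ , s-periodic) , _) m+p≡|s| at-m =
    smallestPeriod-extend {s = s} {w} smallest periodic (subst (length s ≤_) (sym |w|) (n≤1+n (length s))) restrict
    where
    w : List A
    w = s ++ x ∷ []
    |w| : length w ≡ suc (length s)
    |w| = trans (length-++ s) (+-comm (length s) 1)
    at-end : at w (length s) ≡ just x
    at-end = trans (cong (at w) (sym (+-identityʳ (length s)))) (at-++ʳ s (x ∷ []) 0)
    periodic : HasPeriodBelow (length w) p (at w)
    periodic t t+p<|w| with m≤n⇒m<n∨m≡n (s≤s⁻¹ (subst (t + p <_) |w| t+p<|w|))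
    ... | inj₁ t+p<|s| = trans (at-++ˡ s _ (≤-<-trans (m≤m+n t p) t+p<|s|))
                           (trans (s-periodic t t+p<|s|) (sym (at-++ˡ s _ t+p<|s|)))
    ... | inj₂ t+p≡|s| with +-cancelʳ-≡ p t m (trans t+p≡|s| (sym m+p≡|s|))
    ...   | refl = trans (at-++ˡ s _ (subst (m <_) m+p≡|s| (m<m+n m 1≤p)))
                         (trans at-m (trans (sym at-end) (cong (at w) (sym t+p≡|s|))))
    restrict : ∀ j → j ≤ length s → IsPeriod j w → HasPeriodBelow (length s) j (at s)
    restrict j _ (_ , _ , w-periodic) t t+j<|s| =
      trans (sym (at-++ˡ s _ (≤-<-trans (m≤m+n t j) t+j<|s|)))
            (trans (w-periodic t (<-≤-trans t+j<|s| (subst (length s ≤_) (sym |w|) (n≤1+n _))))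
                   (at-++ˡ s _ t+j<|s|))

  smallestPeriod-∷ : ∀ {q x} {s : List A} → IsSmallestPeriod (suc q) s → at s q ≡ just x →
    IsSmallestPeriod (suc q) (x ∷ s)
  smallestPeriod-∷ {q} {x} {s} smallest@((_ , _ , s-periodic) , _) at-q =
    smallestPeriod-extend {s = s} {x ∷ s} smallest periodic (n≤1+n (length s)) restrict
    where
    periodic : HasPeriodBelow (suc (length s)) (suc q) (at (x ∷ s))
    periodic zero    _                = sym at-q
    periodic (suc t) (s≤s t+p<|s|) = s-periodic t t+p<|s|
    restrict : ∀ j → j ≤ length s → IsPeriod j (x ∷ s) → HasPeriodBelow (length s) j (at s)
    restrict j _ (_ , _ , w-periodic) t t+j<|s| = w-periodic (suc t) (s≤s t+j<|s|)

module Walks {A : Set} {n : ℕ} (T : Trie A n) where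
  open Trie T public

  root : Node
  root = zero

  -- the root is its own parent
  par : Node → Node
  par zero    = zero
  par (suc i) = parent i

  up : ℕ → Node → Node
  up zero    u = u
  up (suc t) u = up t (par u)

  up-+ : ∀ a t u → up (a + t) u ≡ up t (up a u)
  up-+ zero    t u = refl
  up-+ (suc a) t u = up-+ a t (par u)

  up-suc : ∀ a u → up (suc a) u ≡ par (up a u)
  up-suc a u = trans (cong (λ z → up z u) (+-comm 1 a)) (up-+ a 1 u)

  up-reaches-root : ∀ t u → toℕ u ≤ t → up t u ≡ root
  up-reaches-root zero    zero    _         = refl
  up-reaches-root (suc t) zero    _         = up-reaches-root t zero z≤n
  up-reaches-root (suc t) (suc i) (s≤s i≤t) =
    up-reaches-root t (parent i) (≤-trans (s≤s⁻¹ (parent< i)) i≤t)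

  lab : Node → Maybe A
  lab zero    = nothing
  lab (suc i) = just (label i)

  lab-just⇒nonroot : ∀ {u x} → lab u ≡ just x → u ≢ root
  lab-just⇒nonroot {zero} () _

  par-lab-injective : ∀ {u v} → u ≢ root → v ≢ root → par u ≡ par v → lab u ≡ lab v → u ≡ v
  par-lab-injective {zero}          u≢root _      _     _     = ⊥-elim (u≢root refl)
  par-lab-injective {suc _} {zero}  _      v≢root _     _     = ⊥-elim (v≢root refl)
  par-lab-injective {suc i} {suc j} _      _      pi≡pj li≡lj = cong suc (distinct i j pi≡pj (just-injective li≡lj))

  parent≢child : ∀ i → parent i ≢ suc i
  parent≢child i eq = <-irrefl (cong toℕ eq) (parent< i)

  path-up : ∀ {u v s} → Path u v s → up (length s) u ≡ v
  path-up here          = refl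
  path-up (step _ path) = path-up path

  path-labels : ∀ {u v s} → Path u v s → AgreeBelow (length s) (at s) (λ t → lab (up t u))
  path-labels (step i path) zero    _          = refl
  path-labels (step i path) (suc t) (s≤s t<n) = path-labels path t t<n

  -- IsRun restated along the walk up from vi; maximality only needs the two one-letter extensions.
  record Run (p : ℕ) (vi vj : Node) : Set where
    field
      len             : ℕ
      1≤p             : 1 ≤ p
      2p≤len          : p + p ≤ len
      reaches         : up len vi ≡ vj
      below-root      : ∀ t → t < len → up t vi ≢ root
      periodic        : HasPeriodBelow len p (λ t → lab (up t vi))
      noShorterPeriod : ∀ j → 0 < j → j < p → ¬ HasPeriodBelow len j (λ t → lab (up t vi))
      ¬extendUp       : ∀ m → m + p ≡ len → up len vi ≢ root → lab (up m vi) ≢ lab (up len vi)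
      ¬extendDown     : ∀ x → x ≢ root → par x ≡ vi → lab x ≢ lab (up p x)

    <p⇒+p<len : ∀ {x} → x < p → x + p < len
    <p⇒+p<len {x} x<p = <-≤-trans (+-monoˡ-< p x<p) 2p≤len

    <p⇒<len : ∀ {x} → x < p → x < len
    <p⇒<len {x} x<p = ≤-<-trans (m≤m+n x p) (<p⇒+p<len x<p)

    lastStart : ℕ
    lastStart = len ∸ p

    lastStart+p≡len : lastStart + p ≡ len
    lastStart+p≡len = m∸n+n≡m (≤-trans (m≤m+n p p) 2p≤len)

    lastStart<len : lastStart < len
    lastStart<len = subst (lastStart <_) lastStart+p≡len (m<m+n lastStart 1≤p)

  module FromIsRun {vi vj : Node} {s : List A} {q : ℕ} (path : Path vi vj s)
    (smallest : IsSmallestPeriod (suc q) s) (2p≤|s| : 2 * suc q ≤ length s)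
    (maximal : ∀ vi' vj' t r → Path vi' vi t → Path vj vj' r → (vi' , vj') ≢ (vi , vj) →
               ¬ IsSmallestPeriod (suc q) (t ++ s ++ r)) where

    labels : AgreeBelow (length s) (at s) (λ t → lab (up t vi))
    labels = path-labels path

    p≤|s| : suc q ≤ length s
    p≤|s| = proj₁ (proj₂ (proj₁ smallest))

    below-root : ∀ t → t < length s → up t vi ≢ root
    below-root t t<|s| = let (x , at-t) = at-defined s t<|s| in lab-just⇒nonroot (trans (sym (labels t t<|s|)) at-t)

    noShorterPeriod : ∀ j → 0 < j → j < suc q → ¬ HasPeriodBelow (length s) j (λ t → lab (up t vi))
    noShorterPeriod j 0<j j<p j-period =
      <⇒≱ j<p (proj₂ smallest j (0<j , ≤-trans (<⇒≤ j<p) p≤|s| , hasPeriodBelow-resp (agreeBelow-sym labels) j-period))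

    ¬extendUp : ∀ m → m + suc q ≡ length s → up (length s) vi ≢ root →
      lab (up m vi) ≢ lab (up (length s) vi)
    ¬extendUp m m+p≡|s| with up (length s) vi | path-up path
    ... | zero  | _    = λ top≢root _ → top≢root refl
    ... | suc e | refl = λ _ same → maximal vi (parent e) [] (label e ∷ []) here (step e here)
      (parent≢child e ∘ cong proj₂)
      (smallestPeriod-∷ʳ {s = s} smallest m+p≡|s| (trans (labels m (subst (m <_) m+p≡|s| (m<m+n m z<s))) same))

    ¬extendDown : ∀ x → x ≢ root → par x ≡ vi → lab x ≢ lab (up (suc q) x)
    ¬extendDown zero    x≢root _    _    = x≢root refl
    ¬extendDown (suc e) _      refl same = maximal (suc e) vj (label e ∷ []) [] (step e here) here
      (parent≢child e ∘ sym ∘ cong proj₁)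
      (subst (λ z → IsSmallestPeriod (suc q) (label e ∷ z)) (sym (++-identityʳ s))
        (smallestPeriod-∷ {s = s} smallest (trans (labels q p≤|s|) (sym same))))

    run : Run (suc q) vi vj
    run = record
      { len = length s ; 1≤p = s≤s z≤n
      ; 2p≤len = subst (λ z → suc q + z ≤ length s) (+-identityʳ (suc q)) 2p≤|s|
      ; reaches = path-up path ; below-root = below-root
      ; periodic = hasPeriodBelow-resp labels (proj₂ (proj₂ (proj₁ smallest)))
      ; noShorterPeriod = noShorterPeriod ; ¬extendUp = ¬extendUp ; ¬extendDown = ¬extendDown }

  isRun⇒run : ∀ {vi vj} → IsRun (vi , vj) → ∃[ p ] Run p vi vj
  isRun⇒run (_ , zero  , _    , _ , ((() , _) , _) , _)
  isRun⇒run (_ , suc q , path , _ , smallest , 2p≤|s| , maximal) =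
    suc q , FromIsRun.run path smallest 2p≤|s| maximal

leastWitness : ∀ {m} {P : Fin m → Set} → (∀ j → Dec (P j)) → ∀ i → P i →
  ∃[ j ] P j × (∀ k → toℕ k < toℕ j → ¬ P k)
leastWitness {suc _} P? i Pi with P? zero
... | yes P0 = zero , P0 , λ _ ()
leastWitness {suc _} P? zero    Pi | no ¬P0 = ⊥-elim (¬P0 Pi)
leastWitness {suc _} P? (suc i) Pi | no ¬P0 with leastWitness (P? ∘ suc) i Pi
... | j , Pj , below = suc j , Pj , λ { zero _ → ¬P0 ; (suc k) (s≤s k<j) → below k k<j }

module Anchors {A : Set} {n : ℕ} (T : Trie A n) (_≟ₗ_ : ∀ i j → Dec (Trie.label T i ≡ Trie.label T j)) where
  open Walks T public

  code : Fin n → ℕ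
  code i = toℕ (proj₁ (leastWitness (λ j → j ≟ₗ i) i refl))

  code<n : ∀ i → code i < n
  code<n i = toℕ<n (proj₁ (leastWitness (λ j → j ≟ₗ i) i refl))

  code-cong : ∀ {i i'} → label i ≡ label i' → code i ≡ code i'
  code-cong {i} {i'} same with leastWitness (λ j → j ≟ₗ i) i refl | leastWitness (λ j → j ≟ₗ i') i' refl
  ... | j , lj≡li , below | j' , lj'≡li' , below' with <-cmp (toℕ j) (toℕ j')
  ...   | tri< j<j' _ _ = ⊥-elim (below' j j<j' (trans lj≡li same))
  ...   | tri≈ _ j≡j' _ = j≡j'
  ...   | tri> _ _ j'<j = ⊥-elim (below j' j'<j (trans lj'≡li' (sym same)))

  code-injective : ∀ {i i'} → code i ≡ code i' → label i ≡ label i'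
  code-injective {i} {i'} same with leastWitness (λ j → j ≟ₗ i) i refl | leastWitness (λ j → j ≟ₗ i') i' refl
  ... | j , lj≡li , _ | j' , lj'≡li' , _ with toℕ-injective same
  ...   | refl = trans (sym lj≡li) lj'≡li'

  -- Two opposite orders on the labels (by code, and by reversed code); in both the root comes first.
  rank : Bool → Node → ℕ
  rank _     zero    = 0
  rank false (suc i) = suc (code i)
  rank true  (suc i) = suc (n ∸ code i)

  rank-injective : ∀ o {u v} → rank o u ≡ rank o v → lab u ≡ lab v
  rank-injective false {zero}  {zero}  _  = refl
  rank-injective true  {zero}  {zero}  _  = refl
  rank-injective false {suc i} {suc j} eq = cong just (code-injective (suc-injective eq))
  rank-injective true  {suc i} {suc j} eq =
    cong just (code-injective (∸-cancelˡ-≡ (<⇒≤ (code<n i)) (<⇒≤ (code<n j)) (suc-injective eq)))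
  rank-injective false {zero}  {suc _} ()
  rank-injective true  {zero}  {suc _} ()
  rank-injective false {suc _} {zero}  ()
  rank-injective true  {suc _} {zero}  ()

  rank-cong : ∀ o {u v} → lab u ≡ lab v → rank o u ≡ rank o v
  rank-cong _     {zero}  {zero}  _  = refl
  rank-cong false {suc i} {suc j} eq = cong suc (code-cong (just-injective eq))
  rank-cong true  {suc i} {suc j} eq = cong (λ c → suc (n ∸ c)) (code-cong (just-injective eq))

  rank≡0⇒root : ∀ o {u} → rank o u ≡ 0 → u ≡ root
  rank≡0⇒root _     {zero} _ = refl
  rank≡0⇒root false {suc _} ()
  rank≡0⇒root true  {suc _} ()

  orient : ∀ {u v} → v ≢ root → (u ≢ root → lab u ≢ lab v) → ∃[ o ] rank o u < rank o v
  orient {v = zero}          v≢root _      = ⊥-elim (v≢root refl)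
  orient {zero}    {suc _}   _      _      = false , z<s
  orient {suc i}   {suc j}   _      differ with <-cmp (code i) (code j)
  ... | tri< ci<cj _ _ = false , s≤s ci<cj
  ... | tri≈ _ ci≡cj _ = ⊥-elim (differ (λ ()) (cong just (code-injective ci≡cj)))
  ... | tri> _ _ cj<ci = true , s≤s (∸-monoʳ-< cj<ci (<⇒≤ (code<n i)))

  word : Bool → Node → Seq
  word o u t = rank o (up t u)

  lyndonPrefix-one : ∀ {k} → k ≢ root → ∃[ o ] LyndonPrefix (word o k) 1
  lyndonPrefix-one {k} k≢root with firstDifference (suc (toℕ k)) (shift 1 (word false k)) (word false k)
  ... | inj₂ constant = ⊥-elim (k≢root (rank≡0⇒root false (begin
    rank false k                    ≡⟨ shift-agree⇒constant constant (toℕ k) (n≤1+n _) ⟨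
    rank false (up (toℕ k) k)       ≡⟨ cong (rank false) (up-reaches-root (toℕ k) k ≤-refl) ⟩
    0                               ∎)))
    where open ≡-Reasoning
  ... | inj₁ (d , _ , agree , differ) with orient lower≢root (λ _ same → differ (rank-cong false same))
    where
    lower≢root : up d k ≢ root
    lower≢root eq = differ (cong (rank false) (trans (trans (up-suc d k) (cong par eq)) (sym eq)))
  ...   | o , drops = o , (λ j 0<j j<1 → ⊥-elim (<⇒≱ j<1 0<j)) ,
    d , (λ t t<d → rank-cong o (rank-injective false (agree t t<d))) , drops

  record Anchored (vi vj c : Node) : Set where
    field
      {period}      : ℕ
      run           : Run period vi vj
      order         : Bool
      offset        : ℕ
      offset<period : offset < period
      offset-up     : up offset vi ≡ c
      lyndonRoot    : LyndonPrefix (word order (par c)) period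

    open Run run

    c-nonroot : c ≢ root
    c-nonroot = subst (_≢ root) offset-up (below-root offset (<p⇒<len offset<period))

    parent-nonroot : par c ≢ root
    parent-nonroot = subst (λ z → par z ≢ root) offset-up λ eq →
      below-root (suc offset) (≤-<-trans (subst (_≤ offset + period) (+-comm offset 1) (+-monoʳ-≤ offset 1≤p))
                                         (<p⇒+p<len offset<period))
                 (trans (up-suc offset vi) eq)

    label-repeats : lab c ≡ lab (up period c)
    label-repeats = subst (λ z → lab z ≡ lab (up period z)) offset-up
      (trans (periodic offset (<p⇒+p<len offset<period)) (cong lab (up-+ offset period vi)))

  open Anchored

  module _ {p vi vj} (R : Run p vi vj) where
    open Run R

    breakingOrder : ∃[ o ] word o vi len < word o vi lastStart
    breakingOrder = orient (below-root lastStart lastStart<len)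
      (λ top≢root same → ¬extendUp lastStart lastStart+p≡len top≢root (sym same))

    word-periodic : ∀ o → HasPeriodBelow len p (word o vi)
    word-periodic o t t+p<len = rank-cong o (periodic t t+p<len)

    word-noShorterPeriod : ∀ o j → 0 < j → j < p → ¬ HasPeriodBelow len j (word o vi)
    word-noShorterPeriod o j 0<j j<p j-period =
      noShorterPeriod j 0<j j<p (λ t t+j<len → rank-injective o (j-period t t+j<len))

  anchor : ∀ {p vi vj} → Run p vi vj → ∃ (Anchored vi vj)
  anchor {zero} R with Run.1≤p R
  ... | ()
  anchor {suc q} {vi} R with breakingOrder R
  ... | o , drops with lyndonPrefix-exists (word o vi) (Run.2p≤len R) (word-periodic R o)
                         (word-noShorterPeriod R o) (Run.lastStart+p≡len R) drops
  ...   | suc a , _ , a<p , prefix = up a vi , record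
    { run = R ; order = o ; offset = a ; offset<period = a<p ; offset-up = refl
    ; lyndonRoot = lyndonPrefix-resp (λ t → cong (rank o) (trans (up-+ (suc a) t vi) (cong (up t) (up-suc a vi)))) prefix }

  module Overlap {p vi vj vi' vj' a a'} (R : Run p vi vj) (R' : Run p vi' vj')
    (a<p : a < p) (a'<p : a' < p) (common : up a vi ≡ up a' vi') where

    module R  = Run R
    module R' = Run R'

    above : ∀ t → up (a + t) vi ≡ up (a' + t) vi'
    above t = trans (up-+ a t vi) (trans (cong (up t) common) (sym (up-+ a' t vi')))

    -- below the common node the two runs coincide, since each letter there recurs p steps higher
    aligned : ∀ s {b b'} → b + s ≡ a → b' + s ≡ a' → up b vi ≡ up b' vi'
    aligned zero {b} {b'} b≡a b'≡a' =
      trans (cong (λ z → up z vi) (trans (sym (+-identityʳ b)) b≡a))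
            (trans common (cong (λ z → up z vi') (trans (sym b'≡a') (+-identityʳ b'))))
    aligned (suc s) {b} {b'} b+s≡a b'+s≡a' =
      par-lab-injective (R.below-root b (R.<p⇒<len b<p)) (R'.below-root b' (R'.<p⇒<len b'<p)) parents labels
      where
      b<p : b < p
      b<p = <-trans (subst (b <_) b+s≡a (m<m+n b z<s)) a<p
      b'<p : b' < p
      b'<p = <-trans (subst (b' <_) b'+s≡a' (m<m+n b' z<s)) a'<p
      parents : par (up b vi) ≡ par (up b' vi')
      parents = trans (sym (up-suc b vi))
        (trans (aligned s (trans (sym (+-suc b s)) b+s≡a) (trans (sym (+-suc b' s)) b'+s≡a')) (up-suc b' vi'))
      w : ℕ
      w = p ∸ suc s
      wrap : ∀ {x y} → x + suc s ≡ y → x + p ≡ y + w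
      wrap {x} x+s≡y = trans (cong (x +_) (sym (m+[n∸m]≡n (≤-trans (m≤n+m (suc s) b) (subst (_≤ p) (sym b+s≡a) (<⇒≤ a<p))))))
                             (trans (sym (+-assoc x (suc s) w)) (cong (_+ w) x+s≡y))
      labels : lab (up b vi) ≡ lab (up b' vi')
      labels = begin
        lab (up b vi)         ≡⟨ R.periodic b (R.<p⇒+p<len b<p) ⟩
        lab (up (b + p) vi)   ≡⟨ cong (λ z → lab (up z vi)) (wrap b+s≡a) ⟩
        lab (up (a + w) vi)   ≡⟨ cong lab (above w) ⟩
        lab (up (a' + w) vi') ≡⟨ cong (λ z → lab (up z vi')) (wrap b'+s≡a') ⟨
        lab (up (b' + p) vi') ≡⟨ R'.periodic b' (R'.<p⇒+p<len b'<p) ⟨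
        lab (up b' vi')       ∎
        where open ≡-Reasoning

    ¬offset< : a < a' → ⊥
    ¬offset< a<a' with m≤n⇒∃[o]m+o≡n a<a'
    ... | s , a+s≡a' = R.¬extendDown x (R'.below-root s (R'.<p⇒<len s<p)) x-child-of-vi labels
      where
      s+a≡a' : suc s + a ≡ a'
      s+a≡a' = trans (cong suc (+-comm s a)) a+s≡a'
      s<p : s < p
      s<p = <-trans (subst (s <_) s+a≡a' (s≤s (m≤m+n s a))) a'<p
      x : Node
      x = up s vi'
      x-child-of-vi : par x ≡ vi
      x-child-of-vi = trans (sym (up-suc s vi')) (sym (aligned a refl s+a≡a'))
      labels : lab x ≡ lab (up p x)
      labels = trans (R'.periodic s (R'.<p⇒+p<len s<p)) (cong lab (up-+ s p vi'))

  run-len-unique : ∀ {p vi vj vj'} (R : Run p vi vj) (R' : Run p vi vj') → ¬ Run.len R < Run.len R'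
  run-len-unique {p} {vi} R R' len<len' = ¬extendUp lastStart lastStart+p≡len (Run.below-root R' len len<len')
    (trans (Run.periodic R' lastStart (subst (_< Run.len R') (sym lastStart+p≡len) len<len'))
           (cong (λ z → lab (up z vi)) lastStart+p≡len))
    where open Run R

  run-top-unique : ∀ {p vi vj vj'} → Run p vi vj → Run p vi vj' → vj ≡ vj'
  run-top-unique {vi = vi} R R' with <-cmp (Run.len R) (Run.len R')
  ... | tri< len<len' _ _ = ⊥-elim (run-len-unique R R' len<len')
  ... | tri≈ _ len≡len' _ = trans (sym (Run.reaches R)) (trans (cong (λ z → up z vi) len≡len') (Run.reaches R'))
  ... | tri> _ _ len'<len = ⊥-elim (run-len-unique R' R len'<len)

  runs-sharing-node : ∀ {p vi vj vi' vj' a a'} → Run p vi vj → Run p vi' vj' → a < p → a' < p →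
    up a vi ≡ up a' vi' → (vi , vj) ≡ (vi' , vj')
  runs-sharing-node {a = a} {a'} R R' a<p a'<p common with <-cmp a a'
  ... | tri< a<a' _ _ = ⊥-elim (Overlap.¬offset< R R' a<p a'<p common a<a')
  ... | tri> _ _ a'<a = ⊥-elim (Overlap.¬offset< R' R a'<p a<p (sym common) a'<a)
  ... | tri≈ _ refl _ with Overlap.aligned R R' a<p a'<p common a refl refl
  ...   | refl = cong (_ ,_) (run-top-unique R R')

  period-one : ∀ {c p o} → lab c ≡ lab (par c) → lab c ≡ lab (up p c) → 1 ≤ p →
    LyndonPrefix (word o (par c)) p → p ≡ 1
  period-one {p = suc zero}    _      _      _ _      = refl
  period-one {c} {suc (suc r)} {o} c~par c~top _ prefix =
    ⊥-elim (lyndonPrefix-head prefix (rank-cong o (trans (sym c~top) c~par)))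

  period-agree-via-one : ∀ {vi vj vi' vj' c} (x : Anchored vi vj c) (y : Anchored vi' vj' c) →
    LyndonPrefix (word (order x) (par c)) 1 → period x ≡ period y
  period-agree-via-one {c = c} x y one = trans x-one (sym (period-one {c = c} c~par (label-repeats y) (Run.1≤p (run y)) (lyndonRoot y)))
    where
    x-one : period x ≡ 1
    x-one = lyndonPrefix-unique (lyndonRoot x) one (Run.1≤p (run x)) z<s
    c~par : lab c ≡ lab (par c)
    c~par = trans (label-repeats x) (cong (λ p → lab (up p c)) x-one)

  bool-cover : ∀ {o o' : Bool} → o ≢ o' → ∀ b → b ≡ o ⊎ b ≡ o'
  bool-cover {false} {false} o≢o' _     = ⊥-elim (o≢o' refl)
  bool-cover {true}  {true}  o≢o' _     = ⊥-elim (o≢o' refl)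
  bool-cover {false} {true}  _    false = inj₁ refl
  bool-cover {false} {true}  _    true  = inj₂ refl
  bool-cover {true}  {false} _    false = inj₂ refl
  bool-cover {true}  {false} _    true  = inj₁ refl

  anchored-period : ∀ {vi vj vi' vj' c} (x : Anchored vi vj c) (y : Anchored vi' vj' c) → period x ≡ period y
  anchored-period {c = c} x y with order x Bool.≟ order y
  ... | yes o≡o' = lyndonPrefix-unique (lyndonRoot x)
    (subst (λ o → LyndonPrefix (word o (par c)) (period y)) (sym o≡o') (lyndonRoot y)) (Run.1≤p (run x)) (Run.1≤p (run y))
  ... | no o≢o' with lyndonPrefix-one (parent-nonroot x)
  ...   | o , one with bool-cover o≢o' o
  ...     | inj₁ refl = period-agree-via-one x y one
  ...     | inj₂ refl = sym (period-agree-via-one y x one)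

  anchored-injective : ∀ {vi vj vi' vj' c} → Anchored vi vj c → Anchored vi' vj' c → (vi , vj) ≡ (vi' , vj')
  anchored-injective {vi' = vi'} {vj'} x y = runs-sharing-node (run x)
    (subst (λ p → Run p vi' vj') (sym same-period) (run y)) (offset<period x)
    (subst (offset y <_) (sym same-period) (offset<period y)) (trans (offset-up x) (sym (offset-up y)))
    where
    same-period : period x ≡ period y
    same-period = anchored-period x y

lookup-injective : ∀ {X : Set} {xs : List X} → Unique xs → ∀ {i j} → lookup xs i ≡ lookup xs j → i ≡ j
lookup-injective (_ ∷ _)           {zero}  {zero}  _     = refl
lookup-injective (x∉xs ∷ _)        {zero}  {suc j} x≡xⱼ  = ⊥-elim (All.lookup x∉xs (∈-lookup j) x≡xⱼ)
lookup-injective (x∉xs ∷ _)        {suc i} {zero}  xᵢ≡x  = ⊥-elim (All.lookup x∉xs (∈-lookup i) (sym xᵢ≡x))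
lookup-injective (_ ∷ xs-unique)   {suc i} {suc j} xᵢ≡xⱼ = cong suc (lookup-injective xs-unique xᵢ≡xⱼ)

module Counting {A : Set} {n' : ℕ} (T : Trie A (suc n'))
  (_≟ₗ_ : ∀ i j → Dec (Trie.label T i ≡ Trie.label T j)) where
  open Anchors T _≟ₗ_

  -- node 1 is a child of the root, so anchors are among the n' nodes numbered from 2
  anchor-index : ∀ {c} → c ≢ root → par c ≢ root → ∃[ e ] c ≡ suc (suc e)
  anchor-index {zero}        c≢root _  = ⊥-elim (c≢root refl)
  anchor-index {suc zero}    _ pc≢root = ⊥-elim (pc≢root (toℕ-injective (n<1⇒n≡0 (parent< zero))))
  anchor-index {suc (suc e)} _ _       = e , refl

  anchorEdge : (r : Node × Node) → IsRun r → ∃[ e ] Anchored (proj₁ r) (proj₂ r) (suc (suc e))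
  anchorEdge r isRun with anchor (proj₂ (isRun⇒run isRun))
  ... | c , x with anchor-index (Anchored.c-nonroot x) (Anchored.parent-nonroot x)
  ...   | e , refl = e , x

  runs-≤ : ∀ runs → Unique runs → All IsRun runs → length runs ≤ n'
  runs-≤ runs unique areRuns = injective⇒≤ edgeOf-injective
    where
    edge : (i : Fin (length runs)) → ∃[ e ] Anchored (proj₁ (lookup runs i)) (proj₂ (lookup runs i)) (suc (suc e))
    edge i = anchorEdge (lookup runs i) (All.lookup areRuns (∈-lookup i))
    edgeOf-injective : ∀ {i j} → proj₁ (edge i) ≡ proj₁ (edge j) → i ≡ j
    edgeOf-injective {i} {j} same = lookup-injective unique (anchored-injective (proj₂ (edge i))
      (subst (λ e → Anchored (proj₁ (lookup runs j)) (proj₂ (lookup runs j)) (suc (suc e))) (sym same) (proj₂ (edge j))))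

-- Ordering the labels needs decidable equality; as the theorem's conclusion is decidable, it may be assumed.
¬¬-decidableLabels : ∀ {A n} (T : Trie A n) → ¬ ¬ (∀ i j → Dec (Trie.label T i ≡ Trie.label T j))
¬¬-decidableLabels T = sequence ¬¬-applicative λ i → sequence ¬¬-applicative λ j → ¬¬-excluded-middle
  where open RawMonad ¬¬-Monad renaming (rawApplicative to ¬¬-applicative)

mainTheorem1 : {A : Set} (n : ℕ) → 1 ≤ n → (T : Trie A n) →
    (runs : List (Trie.Node T × Trie.Node T)) → Unique runs →
    All (Trie.IsRun T) runs → length runs < n
mainTheorem1 (suc n') _ T runs unique areRuns = decidable-stable (length runs <? suc n')
  (¬¬-map (λ _≟ₗ_ → s≤s (Counting.runs-≤ T _≟ₗ_ runs unique areRuns)) (¬¬-decidableLabels T))
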